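{- Let $\mathcal{A}=(Q,T)$ be a $d$-dimensional VASS. There exists a ranking function for $\mathcal{A}$ if and only if there exists a positive ranking function for $\mathcal{A}$.
   Context: A $d$-dimensional VASS is a pair $\mathcal{A}=(Q,T)$ where $Q$ is a finite nonempty set of states and $T\subseteq Q\times\mathbb{Z}^d\times Q$ is a finite set of transitions such that every state has at least one outgoing transition. A linear map for $\mathcal{A}$ is a function on configurations $p\mathbf{v}$ ($p\in Q$, $\mathbf{v}\in\mathbb{N}^d$) of the form $f(p\mathbf{v})=\mathbf{c}_f^\top\mathbf{v}+\mathbf{w}_f(p)$ with $\mathbf{c}_f\in\mathbb{Q}^d$ (the normal) and $\mathbf{w}_f\in\mathbb{Q}^Q$. A transition $(p,\mathbf{u},q)$ is $f$-ranked if $\mathbf{c}_f^\top\mathbf{u}+\mathbf{w}_f(q)\le\mathbf{w}_f(p)-1$. A ranking function is a linear map $f$ with $\mathbf{c}_f\ge\vec 0$ such that all transitions of $\mathcal{A}$ are $f$-ranked; it is positive if every component of $\mathbf{c}_f$ is strictly positive. -}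

module Defs where

open import Data.Nat using (ℕ)
open import Data.Fin using (Fin)
open import Data.Integer using (ℤ)
open import Data.Rational using (ℚ; 0ℚ; 1ℚ; _+_; _*_; _-_; _≤_; _<_)
open import Data.Product using (_×_; _,_; ∃)
open import Data.List using (List; foldr; map; allFin)
open import Data.List.Membership.Propositional using (_∈_)
open import Relation.Binary.PropositionalEquality using (_≡_)

Transition : ℕ → ℕ → Set
Transition n d = Fin n × (Fin d → ℤ) × Fin n

record VASS (d : ℕ) : Set where
  field
    n           : ℕ
    someState   : Fin n
    transitions : List (Transition n d)
    outgoing    : (p : Fin n) → ∃ λ u → ∃ λ q → (p , u , q) ∈ transitions

toℚ : ℤ → ℚ
toℚ z = z Data.Rational./ 1

dot : ∀ {d} → (Fin d → ℚ) → (Fin d → ℤ) → ℚ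
dot {d} c u = foldr _+_ 0ℚ (map (λ i → c i * toℚ (u i)) (allFin d))

-- A linear map f(p v) = c^T v + w(p), given by its normal c and w : Q → ℚ.
record LinearMap (d n : ℕ) : Set where
  constructor linMap
  field
    normal : Fin d → ℚ
    offset : Fin n → ℚ

Ranked : ∀ {d n} → LinearMap d n → Transition n d → Set
Ranked f (p , u , q) =
  dot (LinearMap.normal f) u + LinearMap.offset f q ≤ LinearMap.offset f p - 1ℚ

IsRankingFunction : ∀ {d} (A : VASS d) → LinearMap d (VASS.n A) → Set
IsRankingFunction {d} A f =
  ((i : Fin d) → 0ℚ ≤ LinearMap.normal f i) ×
  (∀ t → t ∈ VASS.transitions A → Ranked f t)

IsPositiveRankingFunction : ∀ {d} (A : VASS d) → LinearMap d (VASS.n A) → Set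
IsPositiveRankingFunction {d} A f =
  IsRankingFunction A f × ((i : Fin d) → 0ℚ < LinearMap.normal f i)

-- Scale a ranking function (c, w) by K and add the all-ones vector to its
-- normal: (K c + 1, K w). Every transition (p, u, q) then drops by at least
-- K - (sum of the entries of u), so choosing K = 1 + (the largest such sum over
-- the finitely many transitions) keeps every transition ranked, while the new
-- normal is strictly positive.
module Submission where

open import Defs
open import Data.Nat using (ℕ)
open import Data.Product using (∃; _×_; _,_)
open import Data.Fin using (Fin)
open import Data.Integer using (ℤ)
open import Data.Rational
  using (ℚ; 0ℚ; 1ℚ; _+_; _*_; _-_; _≤_; _<_; _⊔_; NonNegative; nonNegative)
open import Data.Rational.Properties
open import Data.Rational.Solver using (module +-*-Solver)
open import Data.List using (List; []; _∷_; foldr; map; allFin)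
open import Data.List.Membership.Propositional using (_∈_)
open import Data.List.Relation.Unary.Any using (here; there)
open import Relation.Binary.PropositionalEquality using (_≡_; refl; sym; cong; subst)
open import Relation.Nullary.Decidable using (toWitness)

open +-*-Solver

0≤1 : 0ℚ ≤ 1ℚ
0≤1 = toWitness {a? = 0ℚ ≤? 1ℚ} _

0<1 : 0ℚ < 1ℚ
0<1 = toWitness {a? = 0ℚ <? 1ℚ} _

sum-map-linear : ∀ {A : Set} (K : ℚ) (c e x : A → ℚ) (xs : List A) →
  foldr _+_ 0ℚ (map (λ i → (K * c i + e i) * x i) xs) ≡
  K * foldr _+_ 0ℚ (map (λ i → c i * x i) xs) + foldr _+_ 0ℚ (map (λ i → e i * x i) xs)
sum-map-linear K c e x [] = solve 1 (λ K → con 0ℚ := K :* con 0ℚ :+ con 0ℚ) refl K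
sum-map-linear K c e x (i ∷ xs) rewrite sum-map-linear K c e x xs =
  solve 6 (λ K c e x S T → (K :* c :+ e) :* x :+ (K :* S :+ T) := K :* (c :* x :+ S) :+ (e :* x :+ T))
    refl K (c i) (e i) (x i)
    (foldr _+_ 0ℚ (map (λ i → c i * x i) xs)) (foldr _+_ 0ℚ (map (λ i → e i * x i) xs))

dot-linear : ∀ {d} (K : ℚ) (c e : Fin d → ℚ) (u : Fin d → ℤ) →
  dot (λ i → K * c i + e i) u ≡ K * dot c u + dot e u
dot-linear {d} K c e u = sum-map-linear K c e (λ i → toℚ (u i)) (allFin d)

entrySum : ∀ {d} → (Fin d → ℤ) → ℚ
entrySum u = dot (λ _ → 1ℚ) u

maxEntrySum : ∀ {n d} → List (Transition n d) → ℚ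
maxEntrySum [] = 0ℚ
maxEntrySum ((p , u , q) ∷ ts) = entrySum u ⊔ maxEntrySum ts

maxEntrySum-nonNeg : ∀ {n d} (ts : List (Transition n d)) → 0ℚ ≤ maxEntrySum ts
maxEntrySum-nonNeg [] = ≤-refl
maxEntrySum-nonNeg ((p , u , q) ∷ ts) =
  ≤-trans (maxEntrySum-nonNeg ts) (p≤q⊔p (entrySum u) (maxEntrySum ts))

entrySum≤maxEntrySum : ∀ {n d p u q} (ts : List (Transition n d)) →
  (p , u , q) ∈ ts → entrySum u ≤ maxEntrySum ts
entrySum≤maxEntrySum ((p , u , q) ∷ ts) (here refl) = p≤p⊔q (entrySum u) (maxEntrySum ts)
entrySum≤maxEntrySum ((p , u , q) ∷ ts) (there m) =
  ≤-trans (entrySum≤maxEntrySum ts m) (p≤q⊔p (entrySum u) (maxEntrySum ts))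

scaleAndShift : ∀ {d n} → ℚ → LinearMap d n → LinearMap d n
scaleAndShift K (linMap c w) = linMap (λ i → K * c i + 1ℚ) (λ p → K * w p)

scaleAndShift-normal-pos : ∀ {d n} (K : ℚ) {{_ : NonNegative K}} (f : LinearMap d n) (i : Fin d) →
  0ℚ ≤ LinearMap.normal f i → 0ℚ < LinearMap.normal (scaleAndShift K f) i
scaleAndShift-normal-pos K (linMap c w) i 0≤ci =
  subst (_< K * c i + 1ℚ) (+-identityʳ 0ℚ) (+-mono-≤-< 0≤Kci 0<1)
  where
  0≤Kci : 0ℚ ≤ K * c i
  0≤Kci = subst (_≤ K * c i) (*-zeroʳ K) (*-monoˡ-≤-nonNeg K 0≤ci)

scaleAndShift-ranked : ∀ {d n} (K : ℚ) {{_ : NonNegative K}} (f : LinearMap d n)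
  {p u q} → entrySum u ≤ K - 1ℚ → Ranked f (p , u , q) →
  Ranked (scaleAndShift K f) (p , u , q)
scaleAndShift-ranked K (linMap c w) {p} {u} {q} small ranked = begin
  dot (λ i → K * c i + 1ℚ) u + K * w q
    ≡⟨ cong (_+ K * w q) (dot-linear K c (λ _ → 1ℚ) u) ⟩
  K * dot c u + entrySum u + K * w q
    ≡⟨ solve 4 (λ K D s W → K :* D :+ s :+ K :* W := K :* (D :+ W) :+ s)
         refl K (dot c u) (entrySum u) (w q) ⟩
  K * (dot c u + w q) + entrySum u
    ≤⟨ +-mono-≤ (*-monoˡ-≤-nonNeg K ranked) small ⟩
  K * (w p - 1ℚ) + (K - 1ℚ)
    ≡⟨ solve 2 (λ K W → K :* (W :- con 1ℚ) :+ (K :- con 1ℚ) := K :* W :- con 1ℚ) refl K (w p) ⟩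
  K * w p - 1ℚ ∎
  where open ≤-Reasoning

rankingFunction⇒positiveRankingFunction : ∀ {d} (A : VASS d) {f} → IsRankingFunction A f →
  IsPositiveRankingFunction A (scaleAndShift (1ℚ + maxEntrySum (VASS.transitions A)) f)
rankingFunction⇒positiveRankingFunction A {f} (c≥0 , ranked) =
  ((λ i → <⇒≤ (positive i)) , ranked′) , positive
  where
  M = maxEntrySum (VASS.transitions A)
  K = 1ℚ + M
  instance
    K-nonNeg : NonNegative K
    K-nonNeg = nonNegative (+-mono-≤ 0≤1 (maxEntrySum-nonNeg (VASS.transitions A)))
  K-1≡M : K - 1ℚ ≡ M
  K-1≡M = solve 1 (λ M → (con 1ℚ :+ M) :- con 1ℚ := M) refl M
  positive : ∀ i → 0ℚ < LinearMap.normal (scaleAndShift K f) i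
  positive i = scaleAndShift-normal-pos K f i (c≥0 i)
  ranked′ : ∀ t → t ∈ VASS.transitions A → Ranked (scaleAndShift K f) t
  ranked′ (p , u , q) t∈A = scaleAndShift-ranked K f {p} {u} {q}
    (subst (entrySum u ≤_) (sym K-1≡M) (entrySum≤maxEntrySum (VASS.transitions A) t∈A))
    (ranked (p , u , q) t∈A)

mainTheorem2 : (d : ℕ) (A : VASS d) →
    ((∃ λ f → IsRankingFunction A f) → (∃ λ f → IsPositiveRankingFunction A f)) ×
    ((∃ λ f → IsPositiveRankingFunction A f) → (∃ λ f → IsRankingFunction A f))
mainTheorem2 d A =
  (λ { (f , rf) → _ , rankingFunction⇒positiveRankingFunction A rf }) ,
  (λ { (f , rf , _) → f , rf })
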